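{- The modal logic $\Gamma(\mathbf{LS},2,1)$ has the uniform Lyndon interpolation property.
   Context: Modal formulas use variables, $\bot,\land,\lor,\neg,\to,\Box$. Positive/negative variables: $v^+(p)=\{p\}$, $v^-(p)=\emptyset$, $v^\circ(\bot)=\emptyset$, $\land,\lor,\Box$ preserve polarity ($v^\circ(\varphi\ast\psi)=v^\circ(\varphi)\cup v^\circ(\psi)$, $v^\circ(\Box\varphi)=v^\circ(\varphi)$), $v^\pm(\neg\varphi)=v^\mp(\varphi)$, $v^+(\varphi\to\psi)=v^-(\varphi)\cup v^+(\psi)$, $v^-(\varphi\to\psi)=v^+(\varphi)\cup v^-(\psi)$. $\Gamma(\mathbf{LS},2,1)$ is the set of modal formulas true at every world of every Kripke model on the frame $(W,R)$ with $W=\{r,a,b\}$ and $R$ the reflexive closure of $\{(r,a),(r,b),(a,b),(b,a)\}$ (a root below a two-element final cluster). A logic $L$ has the uniform Lyndon interpolation property iff for every formula $\varphi$ and finite sets $P^+,P^-$ of variables there is $\theta$ with $L\vdash\varphi\to\theta$, $v^\circ(\theta)\subseteq v^\circ(\varphi)\setminus P^\circ$ for $\circ\in\{+,-\}$, and $L\vdash\theta\to\psi$ for every $\psi$ with $L\vdash\varphi\to\psi$ and $v^\circ(\psi)\cap P^\circ=\emptyset$ for $\circ\in\{+,-\}$. -}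

module Defs where

open import Data.Nat using (ℕ)
open import Data.Bool using (Bool; true)
open import Data.List using (List; []; _∷_; _++_)
open import Data.List.Membership.Propositional using (_∈_; _∉_)
open import Data.Product using (_×_; Σ)
open import Data.Sum using (_⊎_)
open import Data.Empty using (⊥)
open import Relation.Nullary using (¬_)
open import Relation.Binary.PropositionalEquality using (_≡_)

data Fm : Set where
  var  : ℕ → Fm
  ⊥'   : Fm
  _∧'_ : Fm → Fm → Fm
  _∨'_ : Fm → Fm → Fm
  ¬'_  : Fm → Fm
  _⇒_  : Fm → Fm → Fm
  □_   : Fm → Fm

mutual
  v⁺ : Fm → List ℕ
  v⁺ (var p)   = p ∷ []
  v⁺ ⊥'        = []
  v⁺ (φ ∧' ψ)  = v⁺ φ ++ v⁺ ψ
  v⁺ (φ ∨' ψ)  = v⁺ φ ++ v⁺ ψ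
  v⁺ (¬' φ)    = v⁻ φ
  v⁺ (φ ⇒ ψ)   = v⁻ φ ++ v⁺ ψ
  v⁺ (□ φ)     = v⁺ φ

  v⁻ : Fm → List ℕ
  v⁻ (var p)   = []
  v⁻ ⊥'        = []
  v⁻ (φ ∧' ψ)  = v⁻ φ ++ v⁻ ψ
  v⁻ (φ ∨' ψ)  = v⁻ φ ++ v⁻ ψ
  v⁻ (¬' φ)    = v⁺ φ
  v⁻ (φ ⇒ ψ)   = v⁺ φ ++ v⁻ ψ
  v⁻ (□ φ)     = v⁻ φ

-- The frame LS(2,1): a root r below a two-element final cluster {a, b}.
data W : Set where
  r a b : W

data R : W → W → Set where
  refl-R : ∀ {w} → R w w
  r-a : R r a
  r-b : R r b
  a-b : R a b
  b-a : R b a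

Valuation : Set
Valuation = ℕ → W → Bool

_,_⊨_ : Valuation → W → Fm → Set
V , w ⊨ var p    = V p w ≡ true
V , w ⊨ ⊥'       = ⊥
V , w ⊨ (φ ∧' ψ) = (V , w ⊨ φ) × (V , w ⊨ ψ)
V , w ⊨ (φ ∨' ψ) = (V , w ⊨ φ) ⊎ (V , w ⊨ ψ)
V , w ⊨ (¬' φ)   = ¬ (V , w ⊨ φ)
V , w ⊨ (φ ⇒ ψ)  = (V , w ⊨ φ) → (V , w ⊨ ψ)
V , w ⊨ (□ φ)    = ∀ v → R w v → V , v ⊨ φ

Γ⊢ : Fm → Set
Γ⊢ φ = ∀ (V : Valuation) (w : W) → V , w ⊨ φ

_⊆_∖_ : List ℕ → List ℕ → List ℕ → Set
A ⊆ B ∖ P = ∀ p → p ∈ A → (p ∈ B) × (p ∉ P)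

Disjoint : List ℕ → List ℕ → Set
Disjoint A P = ∀ p → p ∈ A → p ∉ P

UniformLyndonInterpolation : Set
UniformLyndonInterpolation =
  ∀ (φ : Fm) (P⁺ P⁻ : List ℕ) →
    Σ Fm λ θ →
      Γ⊢ (φ ⇒ θ)
      × (v⁺ θ ⊆ v⁺ φ ∖ P⁺)
      × (v⁻ θ ⊆ v⁻ φ ∖ P⁻)
      × (∀ ψ → Γ⊢ (φ ⇒ ψ) → Disjoint (v⁺ ψ) P⁺ → Disjoint (v⁻ ψ) P⁻ → Γ⊢ (θ ⇒ ψ))

{-# OPTIONS --safe #-}
-- Let A⁺ = v⁺ φ ∖ P⁺ and A⁻ = v⁻ φ ∖ P⁻. Every valuation U on the frame has a characteristic
-- formula, built from the literals p (p ∈ A⁺) and ¬ p (p ∈ A⁻) only, which holds at w under V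
-- iff for some p-morphism f of the frame onto the part generated by w (root to w, cluster onto
-- cluster) passing from U to V ∘ f makes no variable of A⁺ false and no variable of A⁻ true.
-- The interpolant is the disjunction of these formulas over the valuations U with U , r ⊨ φ,
-- which are finitely many up to the variables of φ; φ implies it by pulling V back along f.
-- Conversely, if φ ⇒ ψ is valid and ψ respects P⁺ and P⁻, move U towards V ∘ f as far as the
-- polarities of φ allow: the result still satisfies φ at r, hence ψ, and is below V ∘ f on the
-- positive and above it on the negative variables of ψ, so ψ transfers along f to w.
module Submission where

open import Defs
open import Data.Bool using (Bool; true; false; _∧_; _∨_) renaming (_≟_ to _≟B_)
open import Data.Bool.Properties using (∧-conicalˡ; ∧-conicalʳ; ∨-zeroʳ)
open import Data.Nat using (ℕ) renaming (_≟_ to _≟ℕ_)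
open import Data.List using (List; []; _∷_; _++_; filter; map; cartesianProduct)
open import Data.List.Membership.Propositional using (_∈_; _∉_)
open import Data.List.Membership.Propositional.Properties
  using (∈-++⁻; ∈-++⁺ˡ; ∈-++⁺ʳ; ∈-map⁺; ∈-filter⁺; ∈-filter⁻; ∈-cartesianProduct⁺)
open import Data.List.Membership.DecPropositional _≟ℕ_ using (_∈?_; _∉?_)
open import Data.List.Relation.Binary.Subset.Propositional using (_⊆_)
open import Data.List.Relation.Unary.Any using (here; there)
open import Data.Product using (_×_; _,_; proj₁; proj₂; ∃-syntax)
open import Data.Sum using (_⊎_; inj₁; inj₂; [_,_]′) renaming (map to ⊎-map)
open import Data.Empty using (⊥-elim)
open import Function using (id; _∘_)
open import Relation.Nullary using (Dec; yes; no; contradiction)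
open import Relation.Nullary.Decidable using (_×-dec_; _⊎-dec_; _→-dec_; ¬?; map′; decidable-stable)
open import Relation.Binary.Definitions using (DecidableEquality)
open import Relation.Binary.PropositionalEquality using (_≡_; refl; sym; trans)

sees-a : ∀ w → R w a
sees-a r = r-a
sees-a a = refl-R
sees-a b = b-a

sees-b : ∀ w → R w b
sees-b r = r-b
sees-b a = a-b
sees-b b = refl-R

R? : ∀ u v → Dec (R u v)
R? u a = yes (sees-a u)
R? u b = yes (sees-b u)
R? r r = yes refl-R
R? a r = no λ ()
R? b r = no λ ()

∀W? : {P : W → Set} → (∀ w → Dec (P w)) → Dec (∀ w → P w)
∀W? P? = map′ (λ (x , y , z) → λ { r → x ; a → y ; b → z }) (λ h → h r , h a , h b)
              (P? r ×-dec P? a ×-dec P? b)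

⊤' : Fm
⊤' = ⊥' ⇒ ⊥'

◇_ : Fm → Fm
◇ χ = ¬' (□ (¬' χ))

sat? : ∀ V w χ → Dec (V , w ⊨ χ)
sat? V w (var p)  = V p w ≟B true
sat? V w ⊥'       = no id
sat? V w (χ ∧' ψ) = sat? V w χ ×-dec sat? V w ψ
sat? V w (χ ∨' ψ) = sat? V w χ ⊎-dec sat? V w ψ
sat? V w (¬' χ)   = ¬? (sat? V w χ)
sat? V w (χ ⇒ ψ)  = sat? V w χ →-dec sat? V w ψ
sat? V w (□ χ)    = ∀W? λ v → R? w v →-dec sat? V v χ

◇-cluster : ∀ {V} χ → V , a ⊨ (◇ χ) → (V , a ⊨ χ) ⊎ (V , b ⊨ χ)
◇-cluster {V} χ ◇χ = decidable-stable (sat? V a χ ⊎-dec sat? V b χ) λ ¬χab →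
  ◇χ λ { _ refl-R χa → ¬χab (inj₁ χa) ; _ a-b χb → ¬χab (inj₂ χb) }

◇□-cluster : ∀ {V w} χ → V , w ⊨ (◇ (□ χ)) → (V , a ⊨ χ) × (V , b ⊨ χ)
◇□-cluster {V} χ ◇□χ =
  decidable-stable (sat? V a χ) (λ ¬χa → ◇□χ λ v _ □χ → ¬χa (□χ a (sees-a v))) ,
  decidable-stable (sat? V b χ) (λ ¬χb → ◇□χ λ v _ □χ → ¬χb (□χ b (sees-b v)))

two-point-matching : {Aa Ab Ba Bb : Set} →
                     Aa ⊎ Ab → Ba ⊎ Bb → Aa ⊎ Ba → Ab ⊎ Bb → (Aa × Bb) ⊎ (Ab × Ba)
two-point-matching (inj₁ Aa) (inj₂ Bb) _         _         = inj₁ (Aa , Bb)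
two-point-matching (inj₂ Ab) (inj₁ Ba) _         _         = inj₂ (Ab , Ba)
two-point-matching (inj₁ _)  (inj₁ Ba) _         (inj₁ Ab) = inj₂ (Ab , Ba)
two-point-matching (inj₁ Aa) (inj₁ _)  _         (inj₂ Bb) = inj₁ (Aa , Bb)
two-point-matching (inj₂ _)  (inj₂ Bb) (inj₁ Aa) _         = inj₁ (Aa , Bb)
two-point-matching (inj₂ Ab) (inj₂ _)  (inj₂ Ba) _         = inj₂ (Ab , Ba)

record IsPMorphism (f : W → W) : Set where
  field
    forth : ∀ {u v} → R u v → R (f u) (f v)
    back  : ∀ {u v} → R (f u) v → ∃[ u′ ] R u u′ × f u′ ≡ v

id-pmorphism : IsPMorphism id
id-pmorphism = record { forth = id ; back = λ {_} {v} u→v → v , u→v , refl }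

rootTo : W → Bool → W → W
rootTo w s     r = w
rootTo w false a = a
rootTo w false b = b
rootTo w true  a = b
rootTo w true  b = a

rootTo-forth : ∀ w s {u v} → R u v → R (rootTo w s u) (rootTo w s v)
rootTo-forth w s     {v = r} refl-R = refl-R
rootTo-forth w false {v = a} _      = sees-a _
rootTo-forth w false {v = b} _      = sees-b _
rootTo-forth w true  {v = a} _      = sees-b _
rootTo-forth w true  {v = b} _      = sees-a _

rootTo-back : ∀ w s {u v} → R (rootTo w s u) v → ∃[ u′ ] R u u′ × rootTo w s u′ ≡ v
rootTo-back w false {u} {a} _ = a , sees-a u , refl
rootTo-back w false {u} {b} _ = b , sees-b u , refl
rootTo-back w true  {u} {a} _ = b , sees-b u , refl
rootTo-back w true  {u} {b} _ = a , sees-a u , refl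
rootTo-back w s     {r} {r} refl-R = r , refl-R , refl
rootTo-back w false {a} {r} ()
rootTo-back w false {b} {r} ()
rootTo-back w true  {a} {r} ()
rootTo-back w true  {b} {r} ()

rootTo-pmorphism : ∀ w s → IsPMorphism (rootTo w s)
rootTo-pmorphism w s = record { forth = rootTo-forth w s ; back = rootTo-back w s }

infixl 30 _∘ᵛ_
infix 4 _≤[_]_ _⊑[_,_]_

_∘ᵛ_ : Valuation → (W → W) → Valuation
(V ∘ᵛ f) p u = V p (f u)

_≤[_]_ : Valuation → List ℕ → Valuation → Set
U ≤[ S ] V = ∀ {p} → p ∈ S → ∀ u → U p u ≡ true → V p u ≡ true

_⊑[_,_]_ : Valuation → List ℕ → List ℕ → Valuation → Set
U ⊑[ S⁺ , S⁻ ] V = U ≤[ S⁺ ] V × V ≤[ S⁻ ] U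

module _ {U V : Valuation} {S⁺ S⁻ T⁺ T⁻ : List ℕ} where
  ⊑-++ˡ : U ⊑[ S⁺ ++ T⁺ , S⁻ ++ T⁻ ] V → U ⊑[ S⁺ , S⁻ ] V
  ⊑-++ˡ (up , down) = up ∘ ∈-++⁺ˡ , down ∘ ∈-++⁺ˡ

  ⊑-++ʳ : U ⊑[ S⁺ ++ T⁺ , S⁻ ++ T⁻ ] V → U ⊑[ T⁺ , T⁻ ] V
  ⊑-++ʳ (up , down) = up ∘ ∈-++⁺ʳ S⁺ , down ∘ ∈-++⁺ʳ S⁻

module _ {f : W → W} (f-pmorphism : IsPMorphism f) where
  open IsPMorphism f-pmorphism

  mutual
    preserve : ∀ χ {U V} → U ⊑[ v⁺ χ , v⁻ χ ] V ∘ᵛ f → ∀ u → U , u ⊨ χ → V , f u ⊨ χ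
    preserve (var p)  (up , _) u = up (here refl) u
    preserve ⊥'       _        u = id
    preserve (χ ∧' ψ) U⊑V      u (χu , ψu) =
      preserve χ (⊑-++ˡ U⊑V) u χu , preserve ψ (⊑-++ʳ {S⁺ = v⁺ χ} {v⁻ χ} U⊑V) u ψu
    preserve (χ ∨' ψ) U⊑V      u =
      ⊎-map (preserve χ (⊑-++ˡ U⊑V) u) (preserve ψ (⊑-++ʳ {S⁺ = v⁺ χ} {v⁻ χ} U⊑V) u)
    preserve (¬' χ)   U⊑V      u ¬χ = ¬χ ∘ reflect χ U⊑V u
    preserve (χ ⇒ ψ)  U⊑V      u χ→ψ =
      preserve ψ (⊑-++ʳ {S⁺ = v⁻ χ} {v⁺ χ} U⊑V) u ∘ χ→ψ ∘ reflect χ (⊑-++ˡ U⊑V) u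
    preserve (□ χ)    U⊑V      u □χ v fu→v with back fu→v
    ... | u′ , u→u′ , refl = preserve χ U⊑V u′ (□χ u′ u→u′)

    reflect : ∀ χ {U V} → U ⊑[ v⁻ χ , v⁺ χ ] V ∘ᵛ f → ∀ u → V , f u ⊨ χ → U , u ⊨ χ
    reflect (var p)  (_ , down) u = down (here refl) u
    reflect ⊥'       _          u = id
    reflect (χ ∧' ψ) U⊑V        u (χu , ψu) =
      reflect χ (⊑-++ˡ U⊑V) u χu , reflect ψ (⊑-++ʳ {S⁺ = v⁻ χ} {v⁺ χ} U⊑V) u ψu
    reflect (χ ∨' ψ) U⊑V        u =
      ⊎-map (reflect χ (⊑-++ˡ U⊑V) u) (reflect ψ (⊑-++ʳ {S⁺ = v⁻ χ} {v⁺ χ} U⊑V) u)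
    reflect (¬' χ)   U⊑V        u ¬χ = ¬χ ∘ preserve χ U⊑V u
    reflect (χ ⇒ ψ)  U⊑V        u χ→ψ =
      reflect ψ (⊑-++ʳ {S⁺ = v⁺ χ} {v⁻ χ} U⊑V) u ∘ χ→ψ ∘ preserve χ (⊑-++ˡ U⊑V) u
    reflect (□ χ)    U⊑V        u □χ u′ u→u′ = reflect χ U⊑V u′ (□χ (f u′) (forth u→u′))

module Mixture (U V : Valuation) (Φ⁺ Φ⁻ : List ℕ) where
  -- the valuation closest to V among those M with U ⊑[ Φ⁺ , Φ⁻ ] M
  mixture : Valuation
  mixture p u with p ∈? Φ⁺ | p ∈? Φ⁻
  ... | yes _ | yes _ = U p u
  ... | yes _ | no _  = U p u ∨ V p u
  ... | no _  | yes _ = U p u ∧ V p u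
  ... | no _  | no _  = V p u

  U⊑mixture : U ⊑[ Φ⁺ , Φ⁻ ] mixture
  U⊑mixture = up , down
    where
      up : U ≤[ Φ⁺ ] mixture
      up {p} p∈Φ⁺ u Up with p ∈? Φ⁺ | p ∈? Φ⁻
      ... | yes _    | yes _ = Up
      ... | yes _    | no _  rewrite Up = refl
      ... | no p∉Φ⁺ | _     = contradiction p∈Φ⁺ p∉Φ⁺

      down : mixture ≤[ Φ⁻ ] U
      down {p} p∈Φ⁻ u Mp with p ∈? Φ⁺ | p ∈? Φ⁻
      ... | yes _ | yes _    = Mp
      ... | no _  | yes _    = ∧-conicalˡ (U p u) (V p u) Mp
      ... | _     | no p∉Φ⁻ = contradiction p∈Φ⁻ p∉Φ⁻

  mixture⊑ : ∀ {Ψ⁺ Ψ⁻} →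
             (∀ {p} → p ∈ Φ⁺ → p ∈ Ψ⁺ → ∀ u → U p u ≡ true → V p u ≡ true) →
             (∀ {p} → p ∈ Φ⁻ → p ∈ Ψ⁻ → ∀ u → V p u ≡ true → U p u ≡ true) →
             mixture ⊑[ Ψ⁺ , Ψ⁻ ] V
  mixture⊑ {Ψ⁺} {Ψ⁻} U≤V V≤U = up , down
    where
      up : mixture ≤[ Ψ⁺ ] V
      up {p} p∈Ψ⁺ u Mp with p ∈? Φ⁺ | p ∈? Φ⁻
      ... | yes p∈Φ⁺ | yes _ = U≤V p∈Φ⁺ p∈Ψ⁺ u Mp
      ... | yes p∈Φ⁺ | no _ with U p u in Up
      ...   | true  = U≤V p∈Φ⁺ p∈Ψ⁺ u Up
      ...   | false = Mp
      up {p} p∈Ψ⁺ u Mp | no _ | yes _ = ∧-conicalʳ (U p u) (V p u) Mp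
      up {p} p∈Ψ⁺ u Mp | no _ | no _  = Mp

      down : V ≤[ Ψ⁻ ] mixture
      down {p} p∈Ψ⁻ u Vp with p ∈? Φ⁺ | p ∈? Φ⁻
      ... | yes _ | yes p∈Φ⁻ = V≤U p∈Φ⁻ p∈Ψ⁻ u Vp
      ... | yes _ | no _     rewrite Vp = ∨-zeroʳ (U p u)
      ... | no _  | yes p∈Φ⁻ rewrite Vp | V≤U p∈Φ⁻ p∈Ψ⁻ u Vp = refl
      ... | no _  | no _     = Vp

⋀ ⋁ : {A : Set} → (A → Fm) → List A → Fm
⋀ g []       = ⊤'
⋀ g (x ∷ xs) = g x ∧' ⋀ g xs
⋁ g []       = ⊥'
⋁ g (x ∷ xs) = g x ∨' ⋁ g xs

module _ {A : Set} {V : Valuation} {w : W} {g : A → Fm} where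
  ⋀-intro : ∀ {xs} → (∀ {x} → x ∈ xs → V , w ⊨ g x) → V , w ⊨ ⋀ g xs
  ⋀-intro {[]}    _  = id
  ⋀-intro {_ ∷ _} gs = gs (here refl) , ⋀-intro (gs ∘ there)

  ⋀-elim : ∀ {xs x} → V , w ⊨ ⋀ g xs → x ∈ xs → V , w ⊨ g x
  ⋀-elim (gx , _)  (here refl) = gx
  ⋀-elim (_ , gxs) (there x∈)  = ⋀-elim gxs x∈

  ⋁-intro : ∀ {xs x} → x ∈ xs → V , w ⊨ g x → V , w ⊨ ⋁ g xs
  ⋁-intro (here refl) gx = inj₁ gx
  ⋁-intro (there x∈)  gx = inj₂ (⋁-intro x∈ gx)

  ⋁-elim : ∀ {xs} → V , w ⊨ ⋁ g xs → ∃[ x ] x ∈ xs × V , w ⊨ g x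
  ⋁-elim {_ ∷ _} (inj₁ gx)  = _ , here refl , gx
  ⋁-elim {_ ∷ _} (inj₂ gxs) with ⋁-elim gxs
  ... | x , x∈ , gx = x , there x∈ , gx

positiveLiteral negativeLiteral : Bool → ℕ → Fm
positiveLiteral true  p = var p
positiveLiteral false p = ⊤'
negativeLiteral true  p = ⊤'
negativeLiteral false p = ¬' var p

module _ {V : Valuation} {x : W} where
  positiveLiteral-intro : ∀ c p → (c ≡ true → V p x ≡ true) → V , x ⊨ positiveLiteral c p
  positiveLiteral-intro true  p h = h refl
  positiveLiteral-intro false p _ = id

  positiveLiteral-elim : ∀ c p → V , x ⊨ positiveLiteral c p → c ≡ true → V p x ≡ true
  positiveLiteral-elim true p h _ = h

  negativeLiteral-intro : ∀ c p → (V p x ≡ true → c ≡ true) → V , x ⊨ negativeLiteral c p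
  negativeLiteral-intro true  p _ = id
  negativeLiteral-intro false p h px with h px
  ... | ()

  negativeLiteral-elim : ∀ c p → V , x ⊨ negativeLiteral c p → V p x ≡ true → c ≡ true
  negativeLiteral-elim true  p _  _  = refl
  negativeLiteral-elim false p ¬p px = ⊥-elim (¬p px)

record VarsIn (S⁺ S⁻ : List ℕ) (χ : Fm) : Set where
  constructor mkVarsIn
  field
    positive : v⁺ χ ⊆ S⁺
    negative : v⁻ χ ⊆ S⁻

++-⊆ : ∀ {xs ys zs : List ℕ} → xs ⊆ zs → ys ⊆ zs → xs ++ ys ⊆ zs
++-⊆ {xs} xs⊆ ys⊆ = [ xs⊆ , ys⊆ ]′ ∘ ∈-++⁻ xs

module _ {S⁺ S⁻ : List ℕ} where
  VarsIn-⊥ : VarsIn S⁺ S⁻ ⊥'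
  VarsIn-⊥ = mkVarsIn (λ ()) (λ ())

  VarsIn-⊤ : VarsIn S⁺ S⁻ ⊤'
  VarsIn-⊤ = mkVarsIn (λ ()) (λ ())

  VarsIn-□ : ∀ {χ} → VarsIn S⁺ S⁻ χ → VarsIn S⁺ S⁻ (□ χ)
  VarsIn-□ (mkVarsIn χ⁺ χ⁻) = mkVarsIn χ⁺ χ⁻

  VarsIn-◇ : ∀ {χ} → VarsIn S⁺ S⁻ χ → VarsIn S⁺ S⁻ (◇ χ)
  VarsIn-◇ (mkVarsIn χ⁺ χ⁻) = mkVarsIn χ⁺ χ⁻

  VarsIn-∧ : ∀ {χ ψ} → VarsIn S⁺ S⁻ χ → VarsIn S⁺ S⁻ ψ → VarsIn S⁺ S⁻ (χ ∧' ψ)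
  VarsIn-∧ (mkVarsIn χ⁺ χ⁻) (mkVarsIn ψ⁺ ψ⁻) = mkVarsIn (++-⊆ χ⁺ ψ⁺) (++-⊆ χ⁻ ψ⁻)

  VarsIn-∨ : ∀ {χ ψ} → VarsIn S⁺ S⁻ χ → VarsIn S⁺ S⁻ ψ → VarsIn S⁺ S⁻ (χ ∨' ψ)
  VarsIn-∨ (mkVarsIn χ⁺ χ⁻) (mkVarsIn ψ⁺ ψ⁻) = mkVarsIn (++-⊆ χ⁺ ψ⁺) (++-⊆ χ⁻ ψ⁻)

  VarsIn-⋀ : ∀ {A : Set} {g : A → Fm} xs → (∀ {x} → x ∈ xs → VarsIn S⁺ S⁻ (g x)) →
             VarsIn S⁺ S⁻ (⋀ g xs)
  VarsIn-⋀ []       _  = VarsIn-⊤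
  VarsIn-⋀ (_ ∷ xs) gs = VarsIn-∧ (gs (here refl)) (VarsIn-⋀ xs (gs ∘ there))

  VarsIn-⋁ : ∀ {A : Set} {g : A → Fm} xs → (∀ {x} → x ∈ xs → VarsIn S⁺ S⁻ (g x)) →
             VarsIn S⁺ S⁻ (⋁ g xs)
  VarsIn-⋁ []       _  = VarsIn-⊥
  VarsIn-⋁ (_ ∷ xs) gs = VarsIn-∨ (gs (here refl)) (VarsIn-⋁ xs (gs ∘ there))

  VarsIn-positiveLiteral : ∀ c {p} → p ∈ S⁺ → VarsIn S⁺ S⁻ (positiveLiteral c p)
  VarsIn-positiveLiteral true  p∈ = mkVarsIn (λ { (here refl) → p∈ }) (λ ())
  VarsIn-positiveLiteral false _  = VarsIn-⊤

  VarsIn-negativeLiteral : ∀ c {p} → p ∈ S⁻ → VarsIn S⁺ S⁻ (negativeLiteral c p)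
  VarsIn-negativeLiteral true  _  = VarsIn-⊤
  VarsIn-negativeLiteral false p∈ = mkVarsIn (λ ()) (λ { (here refl) → p∈ })

module Characteristic (A⁺ A⁻ : List ℕ) where
  diagram : Valuation → W → Fm
  diagram U u = ⋀ (λ p → positiveLiteral (U p u) p) A⁺ ∧' ⋀ (λ p → negativeLiteral (U p u) p) A⁻

  -- The last three conjuncts force diagram U a and diagram U b to hold at distinct points
  -- of the final cluster (two-point-matching).
  characteristic : Valuation → Fm
  characteristic U =
    diagram U r ∧'
    ((◇ (□ (diagram U a ∨' diagram U b))) ∧' ((□ (◇ (diagram U a))) ∧' (□ (◇ (diagram U b)))))

  VarsIn-diagram : ∀ U u → VarsIn A⁺ A⁻ (diagram U u)
  VarsIn-diagram U u =
    VarsIn-∧ (VarsIn-⋀ A⁺ (VarsIn-positiveLiteral _)) (VarsIn-⋀ A⁻ (VarsIn-negativeLiteral _))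

  VarsIn-characteristic : ∀ U → VarsIn A⁺ A⁻ (characteristic U)
  VarsIn-characteristic U =
    VarsIn-∧ (d r) (VarsIn-∧ (VarsIn-◇ (VarsIn-□ (VarsIn-∨ (d a) (d b))))
                             (VarsIn-∧ (VarsIn-□ (VarsIn-◇ (d a))) (VarsIn-□ (VarsIn-◇ (d b)))))
    where d = VarsIn-diagram U

  module _ {U V : Valuation} where
    diagram-complete : ∀ {f} → U ⊑[ A⁺ , A⁻ ] V ∘ᵛ f → ∀ u → V , f u ⊨ diagram U u
    diagram-complete (up , down) u =
      ⋀-intro (λ p∈ → positiveLiteral-intro _ _ (up p∈ u)) ,
      ⋀-intro (λ p∈ → negativeLiteral-intro _ _ (down p∈ u))

    diagram-sound : ∀ {f} → (∀ u → V , f u ⊨ diagram U u) → U ⊑[ A⁺ , A⁻ ] V ∘ᵛ f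
    diagram-sound d =
      (λ p∈ u → positiveLiteral-elim _ _ (⋀-elim (proj₁ (d u)) p∈)) ,
      (λ p∈ u → negativeLiteral-elim _ _ (⋀-elim (proj₂ (d u)) p∈))

    characteristic-intro : ∀ {w} → (∀ u → V , rootTo w false u ⊨ diagram U u) →
                           V , w ⊨ characteristic U
    characteristic-intro {w} d =
      d r ,
      (λ none → none a (sees-a w) λ { _ refl-R → inj₁ (d a) ; _ a-b → inj₂ (d b) }) ,
      (λ v _ none → none a (sees-a v) (d a)) ,
      (λ v _ none → none b (sees-b v) (d b))

    characteristic-elim : ∀ {w} → V , w ⊨ characteristic U →
                          ∃[ s ] ∀ u → V , rootTo w s u ⊨ diagram U u
    characteristic-elim {w} (dr , ◇□ , □◇a , □◇b) =
      [ (λ (da , db) → false , λ { r → dr ; a → da ; b → db }) ,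
        (λ (db , da) → true  , λ { r → dr ; a → db ; b → da }) ]′
      (two-point-matching (◇-cluster _ (□◇a a (sees-a w))) (◇-cluster _ (□◇b a (sees-a w)))
                          (proj₁ cluster) (proj₂ cluster))
      where cluster = ◇□-cluster _ ◇□

_≟W_ : DecidableEquality W
r ≟W r = yes refl
a ≟W a = yes refl
b ≟W b = yes refl
r ≟W a = no λ ()
r ≟W b = no λ ()
a ≟W r = no λ ()
a ≟W b = no λ ()
b ≟W r = no λ ()
b ≟W a = no λ ()

update : Valuation → ℕ → W → Bool → Valuation
update U p u c q x with q ≟ℕ p | x ≟W u
... | yes _ | yes _ = c
... | _     | _     = U q x

update-≡ : ∀ U p u c → update U p u c p u ≡ c
update-≡ U p u c with p ≟ℕ p | u ≟W u
... | yes _   | yes _   = refl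
... | no p≢p  | _       = contradiction refl p≢p
... | yes _   | no u≢u  = contradiction refl u≢u

update-agrees : ∀ (U V : Valuation) p u q x → U q x ≡ V q x → update U p u (V p u) q x ≡ V q x
update-agrees U V p u q x Uqx with q ≟ℕ p | x ≟W u
... | yes refl | yes refl = refl
... | yes _    | no _     = Uqx
... | no _     | _        = Uqx

valuationsOn : List (ℕ × W) → List Valuation
valuationsOn []            = (λ _ _ → false) ∷ []
valuationsOn ((p , u) ∷ L) =
  map (λ U → update U p u true) (valuationsOn L) ++ map (λ U → update U p u false) (valuationsOn L)

update-∈ : ∀ {L} (U : Valuation) p u c → U ∈ valuationsOn L →
           update U p u c ∈ valuationsOn ((p , u) ∷ L)
update-∈ U p u true  U∈ = ∈-++⁺ˡ (∈-map⁺ _ U∈)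
update-∈ U p u false U∈ = ∈-++⁺ʳ _ (∈-map⁺ _ U∈)

valuationsOn-complete : ∀ L (V : Valuation) →
  ∃[ U ] U ∈ valuationsOn L × (∀ {q x} → (q , x) ∈ L → U q x ≡ V q x)
valuationsOn-complete []            V = (λ _ _ → false) , here refl , λ ()
valuationsOn-complete ((p , u) ∷ L) V with valuationsOn-complete L V
... | U , U∈ , U≡V = update U p u (V p u) , update-∈ {L} U p u (V p u) U∈ , λ
  { (here refl) → update-≡ U p u (V p u)
  ; (there qx∈) → update-agrees U V p u _ _ (U≡V qx∈) }

worlds : List W
worlds = r ∷ a ∷ b ∷ []

∈-worlds : ∀ u → u ∈ worlds
∈-worlds r = here refl
∈-worlds a = there (here refl)
∈-worlds b = there (there (here refl))

valuations : List ℕ → List Valuation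
valuations X = valuationsOn (cartesianProduct X worlds)

_≈[_]_ : Valuation → List ℕ → Valuation → Set
U ≈[ S ] V = ∀ {p} → p ∈ S → ∀ u → U p u ≡ V p u

valuations-complete : ∀ X (V : Valuation) → ∃[ U ] U ∈ valuations X × U ≈[ X ] V
valuations-complete X V with valuationsOn-complete (cartesianProduct X worlds) V
... | U , U∈ , U≡V = U , U∈ , λ p∈ u → U≡V (∈-cartesianProduct⁺ p∈ (∈-worlds u))

≈⇒⊑ : ∀ {U V S S⁺ S⁻} → U ≈[ S ] V → S⁺ ⊆ S → S⁻ ⊆ S → U ⊑[ S⁺ , S⁻ ] V
≈⇒⊑ U≈V S⁺⊆S S⁻⊆S =
  (λ p∈ u Up → trans (sym (U≈V (S⁺⊆S p∈) u)) Up) , (λ p∈ u Vp → trans (U≈V (S⁻⊆S p∈) u) Vp)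

module UniformInterpolant (φ : Fm) (P⁺ P⁻ : List ℕ) where
  A⁺ A⁻ : List ℕ
  A⁺ = filter (_∉? P⁺) (v⁺ φ)
  A⁻ = filter (_∉? P⁻) (v⁻ φ)

  open Characteristic A⁺ A⁻

  A⁺-intro : ∀ {p} → p ∈ v⁺ φ → p ∉ P⁺ → p ∈ A⁺
  A⁺-intro = ∈-filter⁺ (_∉? P⁺)

  A⁻-intro : ∀ {p} → p ∈ v⁻ φ → p ∉ P⁻ → p ∈ A⁻
  A⁻-intro = ∈-filter⁺ (_∉? P⁻)

  A⁺-elim : ∀ {p} → p ∈ A⁺ → p ∈ v⁺ φ × p ∉ P⁺
  A⁺-elim = ∈-filter⁻ (_∉? P⁺) {xs = v⁺ φ}

  A⁻-elim : ∀ {p} → p ∈ A⁻ → p ∈ v⁻ φ × p ∉ P⁻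
  A⁻-elim = ∈-filter⁻ (_∉? P⁻) {xs = v⁻ φ}

  ⊨φ? : ∀ U → Dec (U , r ⊨ φ)
  ⊨φ? U = sat? U r φ

  models : List Valuation
  models = filter ⊨φ? (valuations (v⁺ φ ++ v⁻ φ))

  models-intro : ∀ {U} → U ∈ valuations (v⁺ φ ++ v⁻ φ) → U , r ⊨ φ → U ∈ models
  models-intro = ∈-filter⁺ ⊨φ?

  models-elim : ∀ {U} → U ∈ models → U , r ⊨ φ
  models-elim = proj₂ ∘ ∈-filter⁻ ⊨φ? {xs = valuations (v⁺ φ ++ v⁻ φ)}

  θ : Fm
  θ = ⋁ characteristic models

  VarsIn-θ : VarsIn A⁺ A⁻ θ
  VarsIn-θ = VarsIn-⋁ models (λ {U} _ → VarsIn-characteristic U)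

  φ⇒θ : Γ⊢ (φ ⇒ θ)
  φ⇒θ V w φw with valuations-complete (v⁺ φ ++ v⁻ φ) (V ∘ᵛ rootTo w false)
  ... | U , U∈ , U≈V = ⋁-intro (models-intro U∈ φU) (characteristic-intro (diagram-complete U⊑V))
    where
      φU : U , r ⊨ φ
      φU = reflect (rootTo-pmorphism w false) φ (≈⇒⊑ U≈V (∈-++⁺ʳ (v⁺ φ)) ∈-++⁺ˡ) r φw

      U⊑V : U ⊑[ A⁺ , A⁻ ] V ∘ᵛ rootTo w false
      U⊑V = ≈⇒⊑ U≈V (∈-++⁺ˡ ∘ proj₁ ∘ A⁺-elim) (∈-++⁺ʳ (v⁺ φ) ∘ proj₁ ∘ A⁻-elim)

  θ⇒ψ : ∀ ψ → Γ⊢ (φ ⇒ ψ) → Disjoint (v⁺ ψ) P⁺ → Disjoint (v⁻ ψ) P⁻ → Γ⊢ (θ ⇒ ψ)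
  θ⇒ψ ψ φ⇒ψ ψ⁺∉P⁺ ψ⁻∉P⁻ V w θw with ⋁-elim θw
  ... | U , U∈ , charU with characteristic-elim charU
  ... | s , diagrams =
    preserve (rootTo-pmorphism w s) ψ (mixture⊑ shared⁺ shared⁻) r (φ⇒ψ mixture r φ-mixture)
    where
      open Mixture U (V ∘ᵛ rootTo w s) (v⁺ φ) (v⁻ φ)

      φ-mixture : mixture , r ⊨ φ
      φ-mixture = preserve id-pmorphism φ U⊑mixture r (models-elim U∈)

      U⊑V : U ⊑[ A⁺ , A⁻ ] V ∘ᵛ rootTo w s
      U⊑V = diagram-sound diagrams

      shared⁺ : ∀ {p} → p ∈ v⁺ φ → p ∈ v⁺ ψ → ∀ u → U p u ≡ true → V p (rootTo w s u) ≡ true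
      shared⁺ p∈φ p∈ψ = proj₁ U⊑V (A⁺-intro p∈φ (ψ⁺∉P⁺ _ p∈ψ))

      shared⁻ : ∀ {p} → p ∈ v⁻ φ → p ∈ v⁻ ψ → ∀ u → V p (rootTo w s u) ≡ true → U p u ≡ true
      shared⁻ p∈φ p∈ψ = proj₂ U⊑V (A⁻-intro p∈φ (ψ⁻∉P⁻ _ p∈ψ))

theorem6p2 : UniformLyndonInterpolation
theorem6p2 φ P⁺ P⁻ =
  θ , φ⇒θ ,
  (λ _ → A⁺-elim ∘ VarsIn.positive VarsIn-θ) ,
  (λ _ → A⁻-elim ∘ VarsIn.negative VarsIn-θ) ,
  θ⇒ψ
  where open UniformInterpolant φ P⁺ P⁻
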